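{- There is a generic set $Y$ of $16$ points in $\mathbb{R}^3$ whose box graph $G_b(Y)$ is the complete graph $K_{16}$.
   Context: A finite set $Y\subset\mathbb{R}^3$ is generic if no two of its points share a coordinate. For $p,q\in Y$, $B[p,q]$ is the smallest closed axis-aligned box containing $p$ and $q$. The box graph $G_b(Y)$ has vertex set $Y$, and $p,q$ are adjacent iff the open interior of $B[p,q]$ contains no point of $Y$. -}

module Defs where

open import Data.Nat using (ℕ; _<_)
open import Data.Fin using (Fin)
open import Data.Product using (_×_; ∃-syntax)
open import Data.Sum using (_⊎_)
open import Relation.Nullary using (¬_)
open import Relation.Binary.PropositionalEquality using (_≢_)

-- A point of "R^3", with coordinates taken in ℕ.
Point : Set
Point = Fin 3 → ℕ

Config : ℕ → Set
Config n = Fin n → Point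

Generic : ∀ {n} → Config n → Set
Generic {n} Y = ∀ (i j : Fin n) → i ≢ j → ∀ (c : Fin 3) → Y i c ≢ Y j c

StrictlyBetween : ℕ → ℕ → ℕ → Set
StrictlyBetween a b x = (a < x × x < b) ⊎ (b < x × x < a)

InOpenBox : Point → Point → Point → Set
InOpenBox p q r = ∀ (c : Fin 3) → StrictlyBetween (p c) (q c) (r c)

BoxAdjacent : ∀ {n} → Config n → Fin n → Fin n → Set
BoxAdjacent {n} Y i j = ¬ (∃[ k ] InOpenBox (Y i) (Y j) (Y k))

BoxGraphComplete : ∀ {n} → Config n → Set
BoxGraphComplete {n} Y = ∀ (i j : Fin n) → i ≢ j → BoxAdjacent Y i j

{-# OPTIONS --safe #-}
module Submission where

open import Defs
open import Data.Product using (_×_; ∃-syntax; _,_)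
open import Data.Nat using (ℕ; _<?_)
import Data.Nat.Properties as ℕ
open import Data.Fin using (Fin; toℕ; zero; suc)
open import Data.Fin.Properties using (all?; any?)
import Data.Fin.Properties as Fin
open import Data.Vec using (Vec; lookup; _∷_; [])
open import Relation.Nullary using (Dec; ¬?)
open import Relation.Nullary.Decidable using (_→-dec_; _×-dec_; _⊎-dec_; toWitness)

strictlyBetween? : ∀ a b x → Dec (StrictlyBetween a b x)
strictlyBetween? a b x = ((a <? x) ×-dec (x <? b)) ⊎-dec ((b <? x) ×-dec (x <? a))

inOpenBox? : ∀ p q r → Dec (InOpenBox p q r)
inOpenBox? p q r = all? λ c → strictlyBetween? (p c) (q c) (r c)

generic? : ∀ {n} (Y : Config n) → Dec (Generic Y)
generic? Y = all? λ i → all? λ j →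
  ¬? (i Fin.≟ j) →-dec all? λ c → ¬? (Y i c ℕ.≟ Y j c)

boxAdjacent? : ∀ {n} (Y : Config n) i j → Dec (BoxAdjacent Y i j)
boxAdjacent? Y i j = ¬? (any? λ k → inOpenBox? (Y i) (Y j) (Y k))

boxGraphComplete? : ∀ {n} (Y : Config n) → Dec (BoxGraphComplete Y)
boxGraphComplete? Y = all? λ i → all? λ j → ¬? (i Fin.≟ j) →-dec boxAdjacent? Y i j

y-coordinates : Vec ℕ 16
y-coordinates = 10 ∷ 12 ∷ 8 ∷ 9 ∷ 14 ∷ 11 ∷ 2 ∷ 5 ∷ 15 ∷ 13 ∷ 0 ∷ 1 ∷ 6 ∷ 7 ∷ 3 ∷ 4 ∷ []

z-coordinates : Vec ℕ 16
z-coordinates = 8 ∷ 9 ∷ 3 ∷ 5 ∷ 2 ∷ 0 ∷ 14 ∷ 15 ∷ 4 ∷ 1 ∷ 11 ∷ 13 ∷ 10 ∷ 12 ∷ 6 ∷ 7 ∷ []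

Y₁₆ : Config 16
Y₁₆ i zero             = toℕ i
Y₁₆ i (suc zero)       = lookup y-coordinates i
Y₁₆ i (suc (suc zero)) = lookup z-coordinates i

proposition10 : ∃[ Y ] (Generic {16} Y × BoxGraphComplete Y)
proposition10 =
  Y₁₆ , toWitness {a? = generic? Y₁₆} _ , toWitness {a? = boxGraphComplete? Y₁₆} _
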